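{- Let $H=(H^\bullet,H^\times)$ be a hypergraph and $\mathcal{H}$ the set of its subhypergraphs, ordered by $\subseteq$. For $X=(X^\bullet,X^\times)\in\mathcal{H}$ define $[\delta,\Delta](X)=(\delta(X^\bullet),\Delta(X^\times))$ and $[\epsilon,\varepsilon](X)=(\epsilon(X^\bullet),\varepsilon(X^\times))$. Then $[\delta,\Delta]$ and $[\epsilon,\varepsilon]$ map $\mathcal{H}$ into $\mathcal{H}$, and they are respectively a dilation and an erosion on the lattice $(\mathcal{H},\subseteq)$.
   Context: A hypergraph is a pair $H=(H^\bullet,H^\times)$ where $H^\bullet$ is a set of vertices and $H^\times=(e_i)_{i\in I}$ is a family of hyperedges indexed by a finite set $I$, each hyperedge $e$ having a vertex set $v(e)\subseteq H^\bullet$. Subsets of $H^\times$ are subfamilies $X^\times=(e_j)_{j\in J}$, $J\subseteq I$. A subhypergraph of $H$ is a pair $X=(X^\bullet,X^\times)$ with $X^\bullet\subseteq H^\bullet$, $X^\times\subseteq H^\times$ and $v(e)\subseteq X^\bullet$ for every $e\in X^\times$; $X\subseteq Y$ means $X^\bullet\subseteq Y^\bullet$ and $X^\times\subseteq Y^\times$. Operators: $\delta^\bullet(X^\times)=\bigcup_{j\in J}v(e_j)$; $\epsilon^\bullet(X^\times)=\bigcap_{i\in I\setminus J}\overline{v(e_i)}$ (complement in $H^\bullet$); $\epsilon^\times(X^\bullet)=\{e_i, i\in I\mid v(e_i)\subseteq X^\bullet\}$; $\delta^\times(X^\bullet)=\{e_i, i\in I\mid v(e_i)\cap X^\bullet\neq\emptyset\}$;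 $\delta=\delta^\bullet\circ\delta^\times$, $\epsilon=\epsilon^\bullet\circ\epsilon^\times$ (on subsets of $H^\bullet$); $\Delta=\delta^\times\circ\delta^\bullet$, $\varepsilon=\epsilon^\times\circ\epsilon^\bullet$ (on subsets of $H^\times$). A dilation on a lattice is an operator commuting with arbitrary suprema (hence preserving the least element); an erosion commutes with arbitrary infima (hence preserves the greatest element). -}

module Defs where

open import Level using (0ℓ)
open import Data.Nat using (ℕ)
open import Data.Fin using (Fin)
open import Data.Product using (Σ; ∃; _×_; _,_; proj₁; proj₂)
open import Relation.Unary using (Pred; _⊆_)

-- A hypergraph: an arbitrary vertex set V (a type), and a finite family of
-- hyperedges indexed by I = Fin n, hyperedge i having vertex set v i ⊆ V.
record Hypergraph : Set₁ where
  field
    V : Set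
    n : ℕ
    v : Fin n → Pred V 0ℓ

module _ (H : Hypergraph) where
  open Hypergraph H

  VSub : Set₁
  VSub = Pred V 0ℓ

  ESub : Set₁
  ESub = Pred (Fin n) 0ℓ

  Pair : Set₁
  Pair = VSub × ESub

  IsSub : Pair → Set
  IsSub (Xv , Xe) = ∀ i → Xe i → v i ⊆ Xv

  _⊑_ : Pair → Pair → Set
  (Xv , Xe) ⊑ (Yv , Ye) = (Xv ⊆ Yv) × (Xe ⊆ Ye)

  δ• : ESub → VSub
  δ• Xe x = ∃ λ i → Xe i × v i x

  -- ε•(X×) = ⋂_{i ∈ I∖J} complement of v(e_i), written as:
  -- x ∈ ε•(X×) iff every hyperedge containing x belongs to X×
  ε• : ESub → VSub
  ε• Xe x = ∀ i → v i x → Xe i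

  ε× : VSub → ESub
  ε× Xv i = v i ⊆ Xv

  δ× : VSub → ESub
  δ× Xv i = ∃ λ x → v i x × Xv x

  δ : VSub → VSub
  δ Xv = δ• (δ× Xv)

  ϵ : VSub → VSub
  ϵ Xv = ε• (ε× Xv)

  Δ : ESub → ESub
  Δ Xe = δ× (δ• Xe)

  ε : ESub → ESub
  ε Xe = ε× (ε• Xe)

  dil : Pair → Pair
  dil (Xv , Xe) = (δ Xv , Δ Xe)

  ero : Pair → Pair
  ero (Xv , Xe) = (ϵ Xv , ε Xe)

  IsLub : {K : Set} → (K → Pair) → Pair → Set₁
  IsLub {K} F S =
    IsSub S × (∀ k → F k ⊑ S) × (∀ U → IsSub U → (∀ k → F k ⊑ U) → S ⊑ U)

  IsGlb : {K : Set} → (K → Pair) → Pair → Set₁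
  IsGlb {K} F S =
    IsSub S × (∀ k → S ⊑ F k) × (∀ U → IsSub U → (∀ k → U ⊑ F k) → U ⊑ S)

  IsDilation : (Pair → Pair) → Set₁
  IsDilation D = (K : Set) (F : K → Pair) → (∀ k → IsSub (F k)) →
                 (S : Pair) → IsLub F S → IsLub (λ k → D (F k)) (D S)

  IsErosion : (Pair → Pair) → Set₁
  IsErosion E = (K : Set) (F : K → Pair) → (∀ k → IsSub (F k)) →
                (S : Pair) → IsGlb F S → IsGlb (λ k → E (F k)) (E S)

-- For a supremum S of F, monotonicity makes [δ,Δ](S) an upper bound of
-- the [δ,Δ](F k); and if U bounds them all, then by 2 and 3
-- [δ,Δ](S) ⊑ [δ,Δ](⋃F) ⊑ ⋃_k [δ,Δ](F k) ⊑ U.  The erosion is dual.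
module Submission where

open import Defs
open import Data.Product using (_×_; _,_; proj₁; proj₂; ∃)

module _ (H : Hypergraph) where

  ⊑-trans : {X Y Z : Pair H} → _⊑_ H X Y → _⊑_ H Y Z → _⊑_ H X Z
  ⊑-trans (XYv , XYe) (YZv , YZe) = (λ x → YZv (XYv x)) , (λ e → YZe (XYe e))

  -- For the dilation, a
  -- hyperedge meeting δ•(X×) meets X• since X is a subhypergraph; for
  -- the erosion, a hyperedge inside ε•(X×) has all its incident
  -- hyperedges in X×, whose vertices lie in X•.
  dil-isSub : (X : Pair H) → IsSub H X → IsSub H (dil H X)
  dil-isSub (Xv , Xe) sX i (y , viy , (j , Xej , vjy)) vix =
    i , (y , viy , sX j Xej vjy) , vix

  ero-isSub : (X : Pair H) → IsSub H X → IsSub H (ero H X)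
  ero-isSub (Xv , Xe) sX i ei vix j vjx = sX j (ei vix j vjx)

  dil-mono : (X Y : Pair H) → _⊑_ H X Y → _⊑_ H (dil H X) (dil H Y)
  dil-mono (Xv , Xe) (Yv , Ye) (XYv , XYe) =
    (λ { (i , (y , viy , Xvy) , vix) → i , (y , viy , XYv Xvy) , vix }) ,
    (λ { (y , viy , (j , Xej , vjy)) → y , viy , (j , XYe Xej , vjy) })

  ero-mono : (X Y : Pair H) → _⊑_ H X Y → _⊑_ H (ero H X) (ero H Y)
  ero-mono (Xv , Xe) (Yv , Ye) (XYv , XYe) =
    (λ h j vjx vjy → XYv (h j vjx vjy)) ,
    (λ h vix j vjx → XYe (h vix j vjx))

  module _ {K : Set} (F : K → Pair H) where

    ⋃ : Pair H
    ⋃ = (λ x → ∃ λ k → proj₁ (F k) x) , (λ i → ∃ λ k → proj₂ (F k) i)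

    ⋂ : Pair H
    ⋂ = (λ x → ∀ k → proj₁ (F k) x) , (λ i → ∀ k → proj₂ (F k) i)

    ⋃-upper : ∀ k → _⊑_ H (F k) ⋃
    ⋃-upper k = (λ Fkx → k , Fkx) , (λ Fki → k , Fki)

    ⋃-least : (U : Pair H) → (∀ k → _⊑_ H (F k) U) → _⊑_ H ⋃ U
    ⋃-least U h = (λ { (k , Fkx) → proj₁ (h k) Fkx }) ,
                  (λ { (k , Fki) → proj₂ (h k) Fki })

    ⋃-isSub : (∀ k → IsSub H (F k)) → IsSub H ⋃
    ⋃-isSub sF i (k , Fki) vix = k , sF k i Fki vix

    ⋂-lower : ∀ k → _⊑_ H ⋂ (F k)
    ⋂-lower k = (λ ⋂x → ⋂x k) , (λ ⋂i → ⋂i k)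

    ⋂-greatest : (U : Pair H) → (∀ k → _⊑_ H U (F k)) → _⊑_ H U ⋂
    ⋂-greatest U h = (λ Ux k → proj₁ (h k) Ux) , (λ Ui k → proj₂ (h k) Ui)

    ⋂-isSub : (∀ k → IsSub H (F k)) → IsSub H ⋂
    ⋂-isSub sF i ⋂i vix k = sF k i (⋂i k) vix

    lub⊑⋃ : (∀ k → IsSub H (F k)) → (S : Pair H) → IsLub H F S → _⊑_ H S ⋃
    lub⊑⋃ sF S (_ , _ , least) = least ⋃ (⋃-isSub sF) ⋃-upper

    ⋂⊑glb : (∀ k → IsSub H (F k)) → (S : Pair H) → IsGlb H F S → _⊑_ H ⋂ S
    ⋂⊑glb sF S (_ , _ , greatest) = greatest ⋂ (⋂-isSub sF) ⋂-lower

  -- Step 3: [δ,Δ] maps anything below ⋃F below ⋃_k [δ,Δ](F k): the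
  -- witness of membership in X lies in some F k.  Dually, [ϵ,ε] maps
  -- anything above ⋂F above ⋂_k [ϵ,ε](F k).
  dil-⋃ : {K : Set} (F : K → Pair H) (X : Pair H) →
          _⊑_ H X (⋃ F) → _⊑_ H (dil H X) (⋃ (λ k → dil H (F k)))
  dil-⋃ F (Xv , Xe) (X⊑v , X⊑e) =
    (λ { (i , (y , viy , Xvy) , vix) →
           let (k , Fky) = X⊑v Xvy in k , i , (y , viy , Fky) , vix }) ,
    (λ { (y , viy , (j , Xej , vjy)) →
           let (k , Fkj) = X⊑e Xej in k , y , viy , (j , Fkj , vjy) })

  ero-⋂ : {K : Set} (F : K → Pair H) (X : Pair H) →
          _⊑_ H (⋂ F) X → _⊑_ H (⋂ (λ k → ero H (F k))) (ero H X)
  ero-⋂ F (Xv , Xe) (⊑Xv , ⊑Xe) =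
    (λ h j vjx vjy → ⊑Xv (λ k → h k j vjx vjy)) ,
    (λ h vix j vjx → ⊑Xe (λ k → h k vix j vjx))

  dilation : IsDilation H (dil H)
  dilation K F sF S lubS@(sS , upper , _) =
    dil-isSub S sS ,
    (λ k → dil-mono (F k) S (upper k)) ,
    λ U _ below → ⊑-trans (dil-⋃ F S (lub⊑⋃ F sF S lubS))
                          (⋃-least (λ k → dil H (F k)) U below)

  erosion : IsErosion H (ero H)
  erosion K F sF S glbS@(sS , lower , _) =
    ero-isSub S sS ,
    (λ k → ero-mono S (F k) (lower k)) ,
    λ U _ above → ⊑-trans (⋂-greatest (λ k → ero H (F k)) U above)
                          (ero-⋂ F S (⋂⊑glb F sF S glbS))

theorem1 : (H : Hypergraph) →
    ((X : Pair H) → IsSub H X → IsSub H (dil H X)) ×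
    ((X : Pair H) → IsSub H X → IsSub H (ero H X)) ×
    IsDilation H (dil H) ×
    IsErosion H (ero H)
theorem1 H = dil-isSub H , ero-isSub H , dilation H , erosion H
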